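{- Let $\mathbb I$ be an interface. For all processes $p,q$, if $p\sqsubseteq^{\mathrm{unc}}_{\mathbb I}q$ then $p\sqsubseteq^{\mathrm{ind}}_{\mathbb I}q$.
   Context: Names $\mathcal N$, co-names $\bar a$ ($\bar{\bar a}=a$), $\mathsf{Act}=\mathcal N\cup\bar{\mathcal N}$, internal action $\tau\notin\mathsf{Act}$, success $\checkmark$. Processes: $p::=\mathbf 0\mid\mathbf 1\mid\mu.p\mid p+q\mid X\mid \mathrm{rec}_X.p$ ($\mu\in\mathsf{Act}\cup\{\tau\}$), with transitions $\mathbf 1\xrightarrow{\checkmark}\mathbf 0$, $\mu.p\xrightarrow{\mu}p$, choice moving as either summand, recursion unfolded. Configurations $c::=p\mid c\parallel d$: interleaving of $\mu$-moves, $\tau$-synchronisation of complementary actions, and $c\parallel d\xrightarrow{\checkmark}c'\parallel d'$ only when both sides do $\checkmark$. $\mathtt n(p)$: names $a$ with $a$ or $\bar a$ occurring in $p$. $p\ \mathsf{must}\ o$ iff every maximal $\tau$-computation of $p\parallel o$ (infinite or ending with no $\tau$-move) passes through a state $p_j\parallel o_j$ with $o_j\xrightarrow{\checkmark}$. An interface is a partition $\mathbb I=\{I_i\}_{i\in0..n}$ of $\mathsf{Act}$ with $\alpha\in I_i\Rightarrow\bar\alpha\in I_i$. Uncoordinated preorder: $p\sqsubseteq^{\mathrm{unc}}_{\mathbb I}q$ iff for all processes $o_0,\dots,o_n$ with $\mathtt n(o_i)\subseteq I_i$, $p\ \mathsf{must}\ (o_0\parallel\cdots\parallel o_n)$ implies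 $q\ \mathsf{must}\ (o_0\parallel\cdots\parallel o_n)$. Projection: $p\setminus I$ has $p\setminus I\xrightarrow{\alpha}p'\setminus I$ if $p\xrightarrow{\alpha}p'$ with $\alpha\in I$, and $p\setminus I\xrightarrow{\tau}p'\setminus I$ if $p\xrightarrow{\alpha}p'$ with $\alpha\in\mathsf{Act}\setminus I$ (other transitions kept with the same label). Individualistic preorder: $p\sqsubseteq^{\mathrm{ind}}_{\mathbb I}q$ iff for all processes $o_0,\dots,o_n$ with $\mathtt n(o_i)\subseteq I_i$ and every $i$, $(p\setminus I_i)\ \mathsf{must}\ o_i$ implies $(q\setminus I_i)\ \mathsf{must}\ o_i$. -}

module Defs where

open import Data.Nat using (ℕ; zero; suc; _<_; _≤_)
open import Data.Fin using (Fin; zero; suc; _≟_)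
open import Data.Bool using (Bool; true; false)
open import Data.Product using (Σ; _×_; _,_; proj₁; proj₂; ∃)
open import Relation.Nullary using (¬_)
open import Relation.Nullary.Decidable using (⌊_⌋)
open import Relation.Binary.PropositionalEquality using (_≡_)

Name : Set
Name = ℕ

-- Act = 𝒩 ∪ co-𝒩 :  nm a  is the name a,  cn a  is the co-name ā.
data Act : Set where
  nm : Name → Act
  cn : Name → Act

co : Act → Act
co (nm a) = cn a
co (cn a) = nm a

data Pre : Set where
  act : Act → Pre
  tau : Pre

data Label : Set where
  ℓact : Act → Label
  ℓτ   : Label
  ℓ✓   : Label

preLabel : Pre → Label
preLabel (act α) = ℓact α
preLabel tau     = ℓτ

-- Process syntax (well-scoped de Bruijn: Proc n has n free variables)

data Proc (n : ℕ) : Set where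
  𝟎   : Proc n
  𝟏   : Proc n
  _·_ : Pre → Proc n → Proc n
  _⊕_ : Proc n → Proc n → Proc n
  var : Fin n → Proc n
  rec : Proc (suc n) → Proc n

Process : Set
Process = Proc 0

ext : {m n : ℕ} → (Fin m → Fin n) → Fin (suc m) → Fin (suc n)
ext ρ zero    = zero
ext ρ (suc i) = suc (ρ i)

rename : {m n : ℕ} → (Fin m → Fin n) → Proc m → Proc n
rename ρ 𝟎       = 𝟎
rename ρ 𝟏       = 𝟏
rename ρ (μ · p) = μ · rename ρ p
rename ρ (p ⊕ q) = rename ρ p ⊕ rename ρ q
rename ρ (var i) = var (ρ i)
rename ρ (rec p) = rec (rename (ext ρ) p)

exts : {m n : ℕ} → (Fin m → Proc n) → Fin (suc m) → Proc (suc n)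
exts σ zero    = var zero
exts σ (suc i) = rename suc (σ i)

subst : {m n : ℕ} → (Fin m → Proc n) → Proc m → Proc n
subst σ 𝟎       = 𝟎
subst σ 𝟏       = 𝟏
subst σ (μ · p) = μ · subst σ p
subst σ (p ⊕ q) = subst σ p ⊕ subst σ q
subst σ (var i) = σ i
subst σ (rec p) = rec (subst (exts σ) p)

unfold : Proc 1 → Process
unfold p = subst (λ _ → rec p) p

infix 4 _—[_]→_
data _—[_]→_ : Process → Label → Process → Set where
  one  : 𝟏 —[ ℓ✓ ]→ 𝟎
  pre  : (μ : Pre) (p : Process) → (μ · p) —[ preLabel μ ]→ p
  sumL : {p q p' : Process} {ℓ : Label} → p —[ ℓ ]→ p' → (p ⊕ q) —[ ℓ ]→ p'
  sumR : {p q q' : Process} {ℓ : Label} → q —[ ℓ ]→ q' → (p ⊕ q) —[ ℓ ]→ q'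
  unf  : {p : Proc 1} {p' : Process} {ℓ : Label} →
         unfold p —[ ℓ ]→ p' → rec p —[ ℓ ]→ p'

data Occurs (a : Name) : {n : ℕ} → Proc n → Set where
  here-nm : {n : ℕ} {p : Proc n} → Occurs a (act (nm a) · p)
  here-cn : {n : ℕ} {p : Proc n} → Occurs a (act (cn a) · p)
  there   : {n : ℕ} {μ : Pre} {p : Proc n} → Occurs a p → Occurs a (μ · p)
  inl     : {n : ℕ} {p q : Proc n} → Occurs a p → Occurs a (p ⊕ q)
  inr     : {n : ℕ} {p q : Proc n} → Occurs a q → Occurs a (p ⊕ q)
  inrec   : {n : ℕ} {p : Proc (suc n)} → Occurs a p → Occurs a (rec p)

-- Configurations (including projected processes p ∖ I, where the set of
-- actions I is given by its characteristic function)

infixr 5 _∥_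
data Conf : Set where
  ⌜_⌝ : Process → Conf
  _∖_ : Process → (Act → Bool) → Conf
  _∥_ : Conf → Conf → Conf

infix 4 _⇒[_]_
data _⇒[_]_ : Conf → Label → Conf → Set where
  lift    : {p p' : Process} {ℓ : Label} → p —[ ℓ ]→ p' → ⌜ p ⌝ ⇒[ ℓ ] ⌜ p' ⌝
  projIn  : {p p' : Process} {I : Act → Bool} {α : Act} →
            p —[ ℓact α ]→ p' → I α ≡ true → (p ∖ I) ⇒[ ℓact α ] (p' ∖ I)
  projOut : {p p' : Process} {I : Act → Bool} {α : Act} →
            p —[ ℓact α ]→ p' → I α ≡ false → (p ∖ I) ⇒[ ℓτ ] (p' ∖ I)
  projτ   : {p p' : Process} {I : Act → Bool} →
            p —[ ℓτ ]→ p' → (p ∖ I) ⇒[ ℓτ ] (p' ∖ I)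
  proj✓   : {p p' : Process} {I : Act → Bool} →
            p —[ ℓ✓ ]→ p' → (p ∖ I) ⇒[ ℓ✓ ] (p' ∖ I)
  parL    : {c c' d : Conf} (μ : Pre) → c ⇒[ preLabel μ ] c' → (c ∥ d) ⇒[ preLabel μ ] (c' ∥ d)
  parR    : {c d d' : Conf} (μ : Pre) → d ⇒[ preLabel μ ] d' → (c ∥ d) ⇒[ preLabel μ ] (c ∥ d')
  sync    : {c c' d d' : Conf} {α : Act} →
            c ⇒[ ℓact α ] c' → d ⇒[ ℓact (co α) ] d' → (c ∥ d) ⇒[ ℓτ ] (c' ∥ d')
  tick    : {c c' d d' : Conf} →
            c ⇒[ ℓ✓ ] c' → d ⇒[ ℓ✓ ] d' → (c ∥ d) ⇒[ ℓ✓ ] (c' ∥ d')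

Step : Conf × Conf → Conf × Conf → Set
Step (c , o) (c' , o') = (c ∥ o) ⇒[ ℓτ ] (c' ∥ o')

Stuck : Conf × Conf → Set
Stuck (c , o) = (e : Conf) → ¬ ((c ∥ o) ⇒[ ℓτ ] e)

Success : Conf × Conf → Set
Success (c , o) = ∃ λ o' → o ⇒[ ℓ✓ ] o'

-- Note: every τ-successor of a state c ∥ o has the
-- form c' ∥ o', so computations are listed as sequences of pairs.
_must_ : Conf → Conf → Set
c must o =
  ((f : ℕ → Conf × Conf) → f 0 ≡ (c , o) →
     ((k : ℕ) → Step (f k) (f (suc k))) →
     Σ ℕ λ j → Success (f j))
  ×
  ((n : ℕ) (f : ℕ → Conf × Conf) → f 0 ≡ (c , o) →
     ((k : ℕ) → k < n → Step (f k) (f (suc k))) →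
     Stuck (f n) →
     Σ ℕ λ j → j ≤ n × Success (f j))

-- Interfaces: a partition {I_i}_{i ∈ 0..n} of Act closed under complement,
-- presented by the block-index map  blk : Act → Fin (suc n).

record Interface : Set where
  field
    n       : ℕ
    blk     : Act → Fin (suc n)
    blk-co  : (α : Act) → blk (co α) ≡ blk α
    blk-nonempty : (i : Fin (suc n)) → ∃ λ α → blk α ≡ i

open Interface public

block : (𝕀 : Interface) → Fin (suc (n 𝕀)) → Act → Bool
block 𝕀 i α = ⌊ blk 𝕀 α ≟ i ⌋

NamesIn : (𝕀 : Interface) → Process → Fin (suc (n 𝕀)) → Set
NamesIn 𝕀 o i = (a : Name) → Occurs a o → blk 𝕀 (nm a) ≡ i

parAll : {m : ℕ} → (Fin (suc m) → Process) → Conf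
parAll {zero}  o = ⌜ o zero ⌝
parAll {suc m} o = ⌜ o zero ⌝ ∥ parAll (λ i → o (suc i))

_⊑unc[_]_ : Process → Interface → Process → Set
p ⊑unc[ 𝕀 ] q =
  (o : Fin (suc (n 𝕀)) → Process) → ((i : Fin (suc (n 𝕀))) → NamesIn 𝕀 (o i) i) →
  ⌜ p ⌝ must parAll o → ⌜ q ⌝ must parAll o

_⊑ind[_]_ : Process → Interface → Process → Set
p ⊑ind[ 𝕀 ] q =
  (o : Fin (suc (n 𝕀)) → Process) → ((i : Fin (suc (n 𝕀))) → NamesIn 𝕀 (o i) i) →
  (i : Fin (suc (n 𝕀))) →
  (p ∖ block 𝕀 i) must ⌜ o i ⌝ → (q ∖ block 𝕀 i) must ⌜ o i ⌝

-- Fix a block I = I_i and an observer o with n(o) ⊆ I.  In every other block k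
-- put the observer rec X. 1 + Σ α.X, summing over the actions α ∈ I_k whose
-- name occurs in p or q: it can always succeed and absorbs, forever, every
-- action of p or q in I_k.  Against the resulting tuple (o in block i) a run
-- of p is, step by step, a run of p ∖ I against o (an action outside I is a
-- τ-move of p ∖ I and a synchronisation with one of the added observers), and
-- the tuple succeeds exactly when o does.  So p ∖ I must o iff p must the
-- tuple, likewise for q, and the uncoordinated preorder applied to the tuple
-- gives the individualistic one.
module Submission where

open import Defs
open import Data.Nat using (ℕ; zero; suc; _<_; _≤_; z≤n; s≤s)
open import Data.Nat.Properties using (≤-refl)
open import Data.Fin using (Fin; zero; suc; _≟_)
open import Data.Fin.Properties using (suc-injective)
open import Data.Vec.Functional using (Vector; tail; updateAt)
open import Data.Vec.Functional.Properties using (updateAt-updates; updateAt-minimal; updateAt-id-local; updateAt-updateAt-local)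
open import Data.Bool using (Bool; true; false)
open import Data.Product using (Σ; ∃; ∃₂; _×_; _,_; proj₁; proj₂)
open import Data.Sum using (_⊎_; inj₁; inj₂; map₁; map₂)
open import Data.Empty using (⊥-elim)
open import Data.List using (List; []; _∷_; _++_; map; filter)
open import Data.List.Membership.Propositional using (_∈_)
open import Data.List.Membership.Propositional.Properties using (∈-++⁺ˡ; ∈-++⁺ʳ; ∈-filter⁺; ∈-filter⁻; ∈-map∘filter⁻)
open import Data.List.Relation.Unary.Any using (here; there)
open import Function using (const; flip)
open import Relation.Nullary using (yes; no; contradiction)
open import Relation.Unary using (Decidable)
open import Relation.Binary.PropositionalEquality using (_≡_; _≢_; _≗_; refl; sym; trans; cong; cong₂)
import Relation.Binary.PropositionalEquality as ≡

nameOf : Act → Name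
nameOf (nm a) = a
nameOf (cn a) = a

nameOf-co : ∀ α → nameOf (co α) ≡ nameOf α
nameOf-co (nm a) = refl
nameOf-co (cn a) = refl

Occurs-rename⁻ : ∀ {a m k} (ρ : Fin m → Fin k) (t : Proc m) → Occurs a (rename ρ t) → Occurs a t
Occurs-rename⁻ ρ (μ · t) here-nm   = here-nm
Occurs-rename⁻ ρ (μ · t) here-cn   = here-cn
Occurs-rename⁻ ρ (μ · t) (there o) = there (Occurs-rename⁻ ρ t o)
Occurs-rename⁻ ρ (t ⊕ u) (inl o)   = inl (Occurs-rename⁻ ρ t o)
Occurs-rename⁻ ρ (t ⊕ u) (inr o)   = inr (Occurs-rename⁻ ρ u o)
Occurs-rename⁻ ρ (rec t) (inrec o) = inrec (Occurs-rename⁻ (ext ρ) t o)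

Occurs-subst⁻ : ∀ {a m k} (σ : Fin m → Proc k) (t : Proc m) → Occurs a (subst σ t) →
                Occurs a t ⊎ ∃ λ j → Occurs a (σ j)
Occurs-subst⁻ σ (μ · t) here-nm   = inj₁ here-nm
Occurs-subst⁻ σ (μ · t) here-cn   = inj₁ here-cn
Occurs-subst⁻ σ (μ · t) (there o) = map₁ there (Occurs-subst⁻ σ t o)
Occurs-subst⁻ σ (t ⊕ u) (inl o)   = map₁ inl (Occurs-subst⁻ σ t o)
Occurs-subst⁻ σ (t ⊕ u) (inr o)   = map₁ inr (Occurs-subst⁻ σ u o)
Occurs-subst⁻ σ (var j) o         = inj₂ (j , o)
Occurs-subst⁻ σ (rec t) (inrec o) with Occurs-subst⁻ (exts σ) t o
... | inj₁ o'             = inj₁ (inrec o')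
... | inj₂ (zero , ())
... | inj₂ (suc j , o')   = inj₂ (j , Occurs-rename⁻ suc (σ j) o')

Occurs-unfold⁻ : ∀ {a} (p : Proc 1) → Occurs a (unfold p) → Occurs a (rec p)
Occurs-unfold⁻ p o with Occurs-subst⁻ (λ _ → rec p) p o
... | inj₁ o'      = inrec o'
... | inj₂ (_ , o') = o'

Occurs-label : ∀ {p p' ℓ α} → p —[ ℓ ]→ p' → ℓ ≡ ℓact α → Occurs (nameOf α) p
Occurs-label (pre (act (nm a)) p) refl = here-nm
Occurs-label (pre (act (cn a)) p) refl = here-cn
Occurs-label (sumL t) e = inl (Occurs-label t e)
Occurs-label (sumR t) e = inr (Occurs-label t e)
Occurs-label (unf {p} t) e = Occurs-unfold⁻ p (Occurs-label t e)

Occurs-derivative : ∀ {p p' ℓ a} → p —[ ℓ ]→ p' → Occurs a p' → Occurs a p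
Occurs-derivative (pre μ p) o = there o
Occurs-derivative (sumL t) o = inl (Occurs-derivative t o)
Occurs-derivative (sumR t) o = inr (Occurs-derivative t o)
Occurs-derivative (unf {p} t) o = Occurs-unfold⁻ p (Occurs-derivative t o)

NamesWithin : (Name → Set) → Process → Set
NamesWithin P p = ∀ a → Occurs a p → P a

NamesWithin-derivative : ∀ {P p p' ℓ} → NamesWithin P p → p —[ ℓ ]→ p' → NamesWithin P p'
NamesWithin-derivative np t a o = np a (Occurs-derivative t o)

names : ∀ {m} → Proc m → List Name
names 𝟎             = []
names 𝟏             = []
names (act α · t)   = nameOf α ∷ names t
names (tau · t)     = names t
names (t ⊕ u)       = names t ++ names u
names (var j)       = []
names (rec t)       = names t

Occurs⇒∈names : ∀ {m a} {t : Proc m} → Occurs a t → a ∈ names t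
Occurs⇒∈names here-nm                       = here refl
Occurs⇒∈names here-cn                       = here refl
Occurs⇒∈names {t = act α · t} (there o)     = there (Occurs⇒∈names o)
Occurs⇒∈names {t = tau · t} (there o)       = Occurs⇒∈names o
Occurs⇒∈names (inl o)                       = ∈-++⁺ˡ (Occurs⇒∈names o)
Occurs⇒∈names {t = t ⊕ u} (inr o)           = ∈-++⁺ʳ (names t) (Occurs⇒∈names o)
Occurs⇒∈names (inrec o)                     = Occurs⇒∈names o

blk-nameOf : (𝕀 : Interface) (α : Act) → blk 𝕀 α ≡ blk 𝕀 (nm (nameOf α))
blk-nameOf 𝕀 (nm a) = refl
blk-nameOf 𝕀 (cn a) = blk-co 𝕀 (nm a)

NamesIn-action : ∀ 𝕀 {k y y' α} → NamesIn 𝕀 y k → y —[ ℓact α ]→ y' → blk 𝕀 α ≡ k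
NamesIn-action 𝕀 {α = α} ny t = trans (blk-nameOf 𝕀 α) (ny (nameOf α) (Occurs-label t refl))

module _ (𝕀 : Interface) {i : Fin (suc (n 𝕀))} {α : Act} where

  block-true : blk 𝕀 α ≡ i → block 𝕀 i α ≡ true
  block-true e with blk 𝕀 α ≟ i
  ... | yes _ = refl
  ... | no ne = contradiction e ne

  block-false : blk 𝕀 α ≢ i → block 𝕀 i α ≡ false
  block-false ne with blk 𝕀 α ≟ i
  ... | yes e = contradiction e ne
  ... | no _  = refl

  block-false⁻ : block 𝕀 i α ≡ false → blk 𝕀 α ≢ i
  block-false⁻ f e = contradiction (trans (sym (block-true e)) f) λ ()

preLabel≢✓ : ∀ μ → preLabel μ ≢ ℓ✓
preLabel≢✓ (act α) ()
preLabel≢✓ tau ()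

data ParStep (c d : Conf) : Label → Conf → Set where
  left   : ∀ {ℓ c'} → ℓ ≢ ℓ✓ → c ⇒[ ℓ ] c' → ParStep c d ℓ (c' ∥ d)
  right  : ∀ {ℓ d'} → ℓ ≢ ℓ✓ → d ⇒[ ℓ ] d' → ParStep c d ℓ (c ∥ d')
  comm   : ∀ {α c' d'} → c ⇒[ ℓact α ] c' → d ⇒[ ℓact (co α) ] d' → ParStep c d ℓτ (c' ∥ d')
  joint✓ : ∀ {c' d'} → c ⇒[ ℓ✓ ] c' → d ⇒[ ℓ✓ ] d' → ParStep c d ℓ✓ (c' ∥ d')

par-step⁻ : ∀ {c d ℓ e} → (c ∥ d) ⇒[ ℓ ] e → ParStep c d ℓ e
par-step⁻ (parL μ s) = left (preLabel≢✓ μ) s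
par-step⁻ (parR μ s) = right (preLabel≢✓ μ) s
par-step⁻ (sync s t) = comm s t
par-step⁻ (tick s t) = joint✓ s t

par-target : ∀ {c d ℓ e} → (c ∥ d) ⇒[ ℓ ] e → ∃₂ λ c' d' → e ≡ (c' ∥ d')
par-target s with par-step⁻ s
... | left _ _   = _ , _ , refl
... | right _ _  = _ , _ , refl
... | comm _ _   = _ , _ , refl
... | joint✓ _ _ = _ , _ , refl

par-tick⁻ : ∀ {c d e} → (c ∥ d) ⇒[ ℓ✓ ] e → (∃ λ c' → c ⇒[ ℓ✓ ] c') × (∃ λ d' → d ⇒[ ℓ✓ ] d')
par-tick⁻ s with par-step⁻ s
... | left ne _   = ⊥-elim (ne refl)
... | right ne _  = ⊥-elim (ne refl)
... | joint✓ s t  = (_ , s) , (_ , t)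

parAll-cong : ∀ {m} {g h : Vector Process (suc m)} → g ≗ h → parAll g ≡ parAll h
parAll-cong {zero}  e = cong ⌜_⌝ (e zero)
parAll-cong {suc m} e = cong₂ _∥_ (cong ⌜_⌝ (e zero)) (parAll-cong (λ k → e (suc k)))

parAll-step : ∀ {m} (g : Vector Process (suc m)) k (μ : Pre) {r} → g k —[ preLabel μ ]→ r →
              parAll g ⇒[ preLabel μ ] parAll (updateAt g k (const r))
parAll-step {zero}  g zero    μ t = lift t
parAll-step {suc m} g zero    μ t = parL μ (lift t)
parAll-step {suc m} g (suc k) μ t = parR μ (parAll-step (tail g) k μ t)

NoSync : ∀ {m} → Vector Process (suc m) → Set
NoSync g = ∀ k k' γ {r r'} → g k —[ ℓact γ ]→ r → g k' —[ ℓact (co γ) ]→ r' → k ≡ k'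

NoSync-tail : ∀ {m} {g : Vector Process (suc (suc m))} → NoSync g → NoSync (tail g)
NoSync-tail ns k k' γ t t' = suc-injective (ns (suc k) (suc k') γ t t')

parAll-step⁻ : ∀ {m} (g : Vector Process (suc m)) {ℓ c} → NoSync g → parAll g ⇒[ ℓ ] c → ℓ ≢ ℓ✓ →
               ∃₂ λ k r → g k —[ ℓ ]→ r × c ≡ parAll (updateAt g k (const r))
parAll-step⁻ {zero} g ns (lift t) _ = zero , _ , t , refl
parAll-step⁻ {suc m} g ns s ne with par-step⁻ s
... | left _ (lift t) = zero , _ , t , refl
... | right _ s' with parAll-step⁻ (tail g) (NoSync-tail ns) s' ne
...   | k , r , t , refl = suc k , r , t , refl
parAll-step⁻ {suc m} g ns s ne | comm (lift t) s' with parAll-step⁻ (tail g) (NoSync-tail ns) s' (λ ())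
... | k , _ , t' , _ with ns zero (suc k) _ t t'
...   | ()
parAll-step⁻ {suc m} g ns s ne | joint✓ _ _ = ⊥-elim (ne refl)

parAll-tick⁻ : ∀ {m} (g : Vector Process (suc m)) {c} → parAll g ⇒[ ℓ✓ ] c → ∀ k → ∃ λ r → g k —[ ℓ✓ ]→ r
parAll-tick⁻ {zero}  g (lift t) zero = _ , t
parAll-tick⁻ {suc m} g s zero with par-tick⁻ s
... | (_ , lift t) , _ = _ , t
parAll-tick⁻ {suc m} g s (suc k) = parAll-tick⁻ (tail g) (proj₂ (proj₂ (par-tick⁻ s))) k

parAll-tick : ∀ {m} (g : Vector Process (suc m)) → (∀ k → ∃ λ r → g k —[ ℓ✓ ]→ r) →
              ∃ λ c → parAll g ⇒[ ℓ✓ ] c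
parAll-tick {zero}  g ticks = _ , lift (proj₂ (ticks zero))
parAll-tick {suc m} g ticks =
  _ , tick (lift (proj₂ (ticks zero))) (proj₂ (parAll-tick (tail g) (λ k → ticks (suc k))))

record MustReflecting (R : Conf × Conf → Conf × Conf → Set) : Set where
  field
    step-forth   : ∀ {s t s'} → R s t → Step s s' → ∃ λ t' → R s' t' × Step t t'
    step-back    : ∀ {s t t'} → R s t → Step t t' → ∃ λ s' → Step s s'
    success-back : ∀ {s t} → R s t → Success t → Success s

module _ {R : Conf × Conf → Conf × Conf → Set} (sim : MustReflecting R) where
  open MustReflecting sim

  stuck-forth : ∀ {s t} → R s t → Stuck s → Stuck t
  stuck-forth r stuck e st with par-target st
  ... | _ , _ , refl = stuck _ (proj₂ (step-back r st))

  simulate-forever : ∀ (f : ℕ → Conf × Conf) {t} → R (f 0) t → (∀ k → Step (f k) (f (suc k))) →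
                     ∃ λ (g : ℕ → Conf × Conf) → g 0 ≡ t × (∀ k → R (f k) (g k)) × (∀ k → Step (g k) (g (suc k)))
  simulate-forever f {t} r steps = (λ k → proj₁ (related k)) , refl , (λ k → proj₂ (related k)) ,
                                   λ k → proj₂ (proj₂ (forth k))
    where
    related : ∀ k → ∃ (R (f k))
    forth : ∀ k → ∃ λ t' → R (f (suc k)) t' × Step (proj₁ (related k)) t'
    related zero    = t , r
    related (suc k) = proj₁ (forth k) , proj₁ (proj₂ (forth k))
    forth k = step-forth (proj₂ (related k)) (steps k)

  simulate-prefix : ∀ m (f : ℕ → Conf × Conf) {t} → R (f 0) t → (∀ k → k < m → Step (f k) (f (suc k))) →
                    ∃ λ (g : ℕ → Conf × Conf) → g 0 ≡ t × (∀ k → k ≤ m → R (f k) (g k)) ×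
                                                (∀ k → k < m → Step (g k) (g (suc k)))
  simulate-prefix zero f {t} r steps = const t , refl , rel₀ , λ _ ()
    where
    rel₀ : ∀ k → k ≤ 0 → R (f k) t
    rel₀ zero z≤n = r
  simulate-prefix (suc m) f {t} r steps
    with step-forth r (steps 0 (s≤s z≤n))
  ... | t' , r' , st
    with simulate-prefix m (λ k → f (suc k)) r' (λ k k<m → steps (suc k) (s≤s k<m))
  ... | g , refl , rel , gsteps = g⁺ , refl , rel⁺ , steps⁺
    where
    g⁺ : ℕ → Conf × Conf
    g⁺ zero    = t
    g⁺ (suc k) = g k
    rel⁺ : ∀ k → k ≤ suc m → R (f k) (g⁺ k)
    rel⁺ zero    _         = r
    rel⁺ (suc k) (s≤s k≤m) = rel k k≤m
    steps⁺ : ∀ k → k < suc m → Step (g⁺ k) (g⁺ (suc k))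
    steps⁺ zero    _         = st
    steps⁺ (suc k) (s≤s k<m) = gsteps k k<m

  must-back : ∀ {c o d e} → R (c , o) (d , e) → d must e → c must o
  must-back {c} {o} {d} {e} r (must-inf , must-fin) = inf , fin
    where
    from : ∀ (f : ℕ → Conf × Conf) → f 0 ≡ (c , o) → R (f 0) (d , e)
    from f f0 = ≡.subst (λ s → R s (d , e)) (sym f0) r
    inf : (f : ℕ → Conf × Conf) → f 0 ≡ (c , o) → (∀ k → Step (f k) (f (suc k))) → ∃ λ j → Success (f j)
    inf f f0 steps with simulate-forever f (from f f0) steps
    ... | g , g0 , rel , gsteps with must-inf g g0 gsteps
    ...   | j , ok = j , success-back (rel j) ok
    fin : ∀ m (f : ℕ → Conf × Conf) → f 0 ≡ (c , o) → (∀ k → k < m → Step (f k) (f (suc k))) →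
          Stuck (f m) → ∃ λ j → j ≤ m × Success (f j)
    fin m f f0 steps stuck with simulate-prefix m f (from f f0) steps
    ... | g , g0 , rel , gsteps with must-fin m g g0 gsteps (stuck-forth (rel m ≤-refl) stuck)
    ...   | j , j≤m , ok = j , j≤m , success-back (rel j j≤m) ok

-- Observers that always succeed and absorb a given list of actions

prefixes : ∀ {m} → List Act → Proc m → Proc m
prefixes []       t = 𝟎
prefixes (α ∷ As) t = (act α · t) ⊕ prefixes As t

permissive : List Act → Process
permissive As = rec (𝟏 ⊕ prefixes As (var zero))

subst-prefixes : ∀ {m k} (σ : Fin m → Proc k) As t → subst σ (prefixes As t) ≡ prefixes As (subst σ t)
subst-prefixes σ []       t = refl
subst-prefixes σ (α ∷ As) t = cong ((act α · subst σ t) ⊕_) (subst-prefixes σ As t)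

unfold-permissive : ∀ As → unfold (𝟏 ⊕ prefixes As (var zero)) ≡ 𝟏 ⊕ prefixes As (permissive As)
unfold-permissive As = cong (𝟏 ⊕_) (subst-prefixes _ As (var zero))

prefixes-step : ∀ {α As} {t : Process} → α ∈ As → prefixes As t —[ ℓact α ]→ t
prefixes-step {α} {t = t} (here refl) = sumL (pre (act α) t)
prefixes-step (there m) = sumR (prefixes-step m)

prefixes-step⁻ : ∀ {As ℓ r} {t : Process} → prefixes As t —[ ℓ ]→ r → ∃ λ α → α ∈ As × ℓ ≡ ℓact α × r ≡ t
prefixes-step⁻ {α ∷ As} (sumL (pre _ _)) = α , here refl , refl , refl
prefixes-step⁻ {α ∷ As} (sumR s) with prefixes-step⁻ s
... | β , m , e , e' = β , there m , e , e'

Occurs-prefixes⁻ : ∀ {m a As} {t : Proc m} → Occurs a (prefixes As t) → Occurs a t ⊎ a ∈ map nameOf As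
Occurs-prefixes⁻ {As = nm b ∷ As} (inl here-nm)   = inj₂ (here refl)
Occurs-prefixes⁻ {As = cn b ∷ As} (inl here-cn)   = inj₂ (here refl)
Occurs-prefixes⁻ {As = α ∷ As} (inl (there o))   = inj₁ o
Occurs-prefixes⁻ {As = α ∷ As} (inr o)            = map₂ there (Occurs-prefixes⁻ o)

permissive-step : ∀ {α As} → α ∈ As → permissive As —[ ℓact α ]→ permissive As
permissive-step {α} {As} m =
  unf (≡.subst (_—[ ℓact α ]→ permissive As) (sym (unfold-permissive As)) (sumR (prefixes-step m)))

permissive-tick : ∀ As → permissive As —[ ℓ✓ ]→ 𝟎
permissive-tick As = unf (sumL one)

permissive-step⁻ : ∀ {As ℓ r} → permissive As —[ ℓ ]→ r →
                   ℓ ≡ ℓ✓ ⊎ ∃ λ α → α ∈ As × ℓ ≡ ℓact α × r ≡ permissive As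
permissive-step⁻ {As} {ℓ} {r} (unf s) = body-step⁻ (≡.subst (_—[ ℓ ]→ r) (unfold-permissive As) s)
  where
  body-step⁻ : 𝟏 ⊕ prefixes As (permissive As) —[ ℓ ]→ r →
               ℓ ≡ ℓ✓ ⊎ ∃ λ α → α ∈ As × ℓ ≡ ℓact α × r ≡ permissive As
  body-step⁻ (sumL one) = inj₁ refl
  body-step⁻ (sumR s')  = inj₂ (prefixes-step⁻ s')

Occurs-permissive⁻ : ∀ {a As} → Occurs a (permissive As) → a ∈ map nameOf As
Occurs-permissive⁻ (inrec (inr o)) with Occurs-prefixes⁻ o
... | inj₂ m = m

actionsOver : List Name → List Act
actionsOver []      = []
actionsOver (a ∷ L) = nm a ∷ cn a ∷ actionsOver L

∈-actionsOver : ∀ {α L} → nameOf α ∈ L → α ∈ actionsOver L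
∈-actionsOver {nm a} (here refl) = here refl
∈-actionsOver {cn a} (here refl) = there (here refl)
∈-actionsOver (there m)          = there (there (∈-actionsOver m))

module Completion (𝕀 : Interface) (i : Fin (suc (n 𝕀))) (L : List Name) where

  I : Act → Bool
  I = block 𝕀 i

  inBlock? : ∀ k → Decidable (λ α → blk 𝕀 α ≡ k)
  inBlock? k α = blk 𝕀 α ≟ k

  partner : Fin (suc (n 𝕀)) → Process
  partner k = permissive (filter (inBlock? k) (actionsOver L))

  partner-acts : ∀ {β} → nameOf β ∈ L → partner (blk 𝕀 β) —[ ℓact β ]→ partner (blk 𝕀 β)
  partner-acts m = permissive-step (∈-filter⁺ (inBlock? _) (∈-actionsOver m) refl)

  partner-step⁻ : ∀ {k ℓ r} → partner k —[ ℓ ]→ r →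
                  ℓ ≡ ℓ✓ ⊎ ∃ λ α → blk 𝕀 α ≡ k × ℓ ≡ ℓact α × r ≡ partner k
  partner-step⁻ s with permissive-step⁻ s
  ... | inj₁ e                = inj₁ e
  ... | inj₂ (α , m , e , e') = inj₂ (α , proj₂ (∈-filter⁻ (inBlock? _) {xs = actionsOver L} m) , e , e')

  partner-names : ∀ k → NamesIn 𝕀 (partner k) k
  partner-names k a o with ∈-map∘filter⁻ nameOf (inBlock? k) {xs = actionsOver L} (Occurs-permissive⁻ o)
  ... | α , _ , refl , bα = trans (sym (blk-nameOf 𝕀 α)) bα

  completion : Process → Vector Process (suc (n 𝕀))
  completion y = updateAt partner i (const y)

  completed : Process → Conf
  completed y = parAll (completion y)

  completion-i : ∀ y → completion y i ≡ y
  completion-i y = updateAt-updates i partner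

  completion-≢ : ∀ y {k} → k ≢ i → completion y k ≡ partner k
  completion-≢ y {k} ne = updateAt-minimal k i partner ne

  completion-names : ∀ {y} → NamesIn 𝕀 y i → ∀ k → NamesIn 𝕀 (completion y k) k
  completion-names {y} ny k a o with k ≟ i
  ... | yes refl = ny a (≡.subst (Occurs a) (completion-i y) o)
  ... | no ne    = partner-names k a (≡.subst (Occurs a) (completion-≢ y ne) o)

  completion-action : ∀ {y k α r} → NamesIn 𝕀 y i → completion y k —[ ℓact α ]→ r → blk 𝕀 α ≡ k
  completion-action {y} {k} {α} {r} ny t with k ≟ i
  ... | yes refl = NamesIn-action 𝕀 ny (≡.subst (_—[ ℓact α ]→ r) (completion-i y) t)
  ... | no ne with partner-step⁻ (≡.subst (_—[ ℓact α ]→ r) (completion-≢ y ne) t)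
  ...   | inj₂ (_ , bα , refl , _) = bα

  -- Each component acts only within its own block, and complementary actions share a block.
  completion-noSync : ∀ {y} → NamesIn 𝕀 y i → NoSync (completion y)
  completion-noSync ny k k' γ t t' =
    trans (sym (completion-action ny t)) (trans (sym (blk-co 𝕀 γ)) (completion-action ny t'))

  completion-replace : ∀ y y' → updateAt (completion y) i (const y') ≗ completion y'
  completion-replace y y' = updateAt-updateAt-local i partner refl

  completion-keep : ∀ y {k} → k ≢ i → updateAt (completion y) k (const (partner k)) ≗ completion y
  completion-keep y {k} ne = updateAt-id-local k (completion y) (sym (completion-≢ y ne))

  completed-moves : ∀ {y y'} μ → y —[ preLabel μ ]→ y' → completed y ⇒[ preLabel μ ] completed y'
  completed-moves {y} {y'} μ t =
    ≡.subst (completed y ⇒[ preLabel μ ]_) (parAll-cong (completion-replace y y'))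
      (parAll-step (completion y) i μ (≡.subst (_—[ preLabel μ ]→ y') (sym (completion-i y)) t))

  completed-absorbs : ∀ {y β} → blk 𝕀 β ≢ i → nameOf β ∈ L → completed y ⇒[ ℓact β ] completed y
  completed-absorbs {y} {β} ne m =
    ≡.subst (completed y ⇒[ ℓact β ]_) (parAll-cong (completion-keep y ne))
      (parAll-step (completion y) (blk 𝕀 β) (act β)
        (≡.subst (_—[ ℓact β ]→ partner (blk 𝕀 β)) (sym (completion-≢ y ne)) (partner-acts m)))

  data CompletedStep (y : Process) : Label → Conf → Set where
    observer-moves : ∀ {ℓ y'} → y —[ ℓ ]→ y' → CompletedStep y ℓ (completed y')
    partner-moves  : ∀ {α} → blk 𝕀 α ≢ i → CompletedStep y (ℓact α) (completed y)

  completed-step⁻ : ∀ {y ℓ d} → NamesIn 𝕀 y i → completed y ⇒[ ℓ ] d → ℓ ≢ ℓ✓ → CompletedStep y ℓ d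
  completed-step⁻ {y} {ℓ} ny s ne with parAll-step⁻ (completion y) (completion-noSync ny) s ne
  ... | k , r , t , refl with k ≟ i
  ...   | yes refl =
    ≡.subst (CompletedStep y ℓ) (sym (parAll-cong (completion-replace y r)))
      (observer-moves (≡.subst (_—[ ℓ ]→ r) (completion-i y) t))
  ...   | no k≢i with partner-step⁻ (≡.subst (_—[ ℓ ]→ r) (completion-≢ y k≢i) t)
  ...     | inj₁ refl = ⊥-elim (ne refl)
  ...     | inj₂ (α , bα , refl , refl) =
    ≡.subst (CompletedStep y ℓ) (sym (parAll-cong (completion-keep y k≢i)))
      (partner-moves λ b → k≢i (trans (sym bα) b))

  completed-tick : ∀ {y d} → ⌜ y ⌝ ⇒[ ℓ✓ ] d → ∃ λ o → completed y ⇒[ ℓ✓ ] o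
  completed-tick {y} (lift {p' = y'} t) = parAll-tick (completion y) component-tick
    where
    component-tick : ∀ k → ∃ λ r → completion y k —[ ℓ✓ ]→ r
    component-tick k with k ≟ i
    ... | yes refl = y' , ≡.subst (_—[ ℓ✓ ]→ y') (sym (completion-i y)) t
    ... | no ne    = 𝟎 , ≡.subst (_—[ ℓ✓ ]→ 𝟎) (sym (completion-≢ y ne)) (permissive-tick _)

  completed-tick⁻ : ∀ {y o} → completed y ⇒[ ℓ✓ ] o → ∃ λ d → ⌜ y ⌝ ⇒[ ℓ✓ ] d
  completed-tick⁻ {y} s with parAll-tick⁻ (completion y) s i
  ... | r , t = ⌜ r ⌝ , lift (≡.subst (_—[ ℓ✓ ]→ r) (completion-i y) t)

  data Related : Conf × Conf → Conf × Conf → Set where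
    related : ∀ {x y} → NamesWithin (_∈ L) x → NamesIn 𝕀 y i → Related (⌜ x ⌝ , completed y) (x ∖ I , ⌜ y ⌝)

  related-forth : ∀ {s t s'} → Related s t → Step s s' → ∃ λ t' → Related s' t' × Step t t'
  related-forth (related nx ny) st with par-step⁻ st
  ... | left _ (lift t) = _ , related (NamesWithin-derivative nx t) ny , parL tau (projτ t)
  ... | right _ s with completed-step⁻ ny s (λ ())
  ...   | observer-moves u = _ , related nx (NamesWithin-derivative ny u) , parR tau (lift u)
  related-forth (related nx ny) st | comm {α} (lift t) s with completed-step⁻ ny s (λ ())
  ... | observer-moves u =
    _ , related (NamesWithin-derivative nx t) (NamesWithin-derivative ny u) ,
    sync (projIn t (block-true 𝕀 (trans (sym (blk-co 𝕀 α)) (NamesIn-action 𝕀 ny u)))) (lift u)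
  ... | partner-moves nb =
    _ , related (NamesWithin-derivative nx t) ny ,
    parL tau (projOut t (block-false 𝕀 λ b → nb (trans (blk-co 𝕀 α) b)))

  related-back : ∀ {s t t'} → Related s t → Step t t' → ∃ λ s' → Related s' t' × Step s s'
  related-back (related nx ny) st with par-step⁻ st
  ... | left _ (projτ t) = _ , related (NamesWithin-derivative nx t) ny , parL tau (lift t)
  ... | left _ (projOut {α = α} t f) =
    _ , related (NamesWithin-derivative nx t) ny ,
    sync (lift t) (completed-absorbs (λ b → block-false⁻ 𝕀 f (trans (sym (blk-co 𝕀 α)) b))
                    (≡.subst (_∈ L) (sym (nameOf-co α)) (nx _ (Occurs-label t refl))))
  ... | right _ (lift u) = _ , related nx (NamesWithin-derivative ny u) , parR tau (completed-moves tau u)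
  ... | comm {α} (projIn t _) (lift u) =
    _ , related (NamesWithin-derivative nx t) (NamesWithin-derivative ny u) ,
    sync (lift t) (completed-moves (act (co α)) u)

  completion-reflects : MustReflecting Related
  completion-reflects = record
    { step-forth   = related-forth
    ; step-back    = λ r st → let (s' , _ , st') = related-back r st in s' , st'
    ; success-back = λ { (related _ _) (_ , s) → completed-tick s }
    }

  projection-reflects : MustReflecting (flip Related)
  projection-reflects = record
    { step-forth   = related-back
    ; step-back    = λ r st → let (t' , _ , st') = related-forth r st in t' , st'
    ; success-back = λ { (related _ _) (_ , s) → completed-tick⁻ s }
    }

proposition5p3 : (𝕀 : Interface) (p q : Process) → p ⊑unc[ 𝕀 ] q → p ⊑ind[ 𝕀 ] q
proposition5p3 𝕀 p q p⊑q o o-names i p-must =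
  must-back projection-reflects (related q-names (o-names i))
    (p⊑q (completion (o i)) (completion-names (o-names i))
      (must-back completion-reflects (related p-names (o-names i)) p-must))
  where
  open Completion 𝕀 i (names p ++ names q)
  p-names : NamesWithin (_∈ names p ++ names q) p
  p-names a o = ∈-++⁺ˡ (Occurs⇒∈names o)
  q-names : NamesWithin (_∈ names p ++ names q) q
  q-names a o = ∈-++⁺ʳ (names p) (Occurs⇒∈names o)
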